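{- Let $D$ be a finite digraph and let $A\subseteq V(D)$ be such that the induced subdigraph $D[A]$ is acyclic. Then there exists a quasikernel $Q\subseteq V(D)$ of $D$ such that $A\subseteq N^+[Q]$.
   Context: A digraph is acyclic if it contains no directed cycles. A set is independent if there are no arcs between two of its vertices. $\mathrm{dist}(S,v)$ is the minimum over $u\in S$ of the length of a shortest directed path from $u$ to $v$. A quasikernel is an independent set $Q$ with $\mathrm{dist}(Q,v)\le 2$ for all $v\in V(D)$. For $S\subseteq V(D)$, $N^+[S]=S\cup\{v:\exists u\in S,\ uv\in E(D)\}$. -}

module Defs where

open import Data.Nat using (ℕ)
open import Data.Fin using (Fin)
open import Data.Fin.Subset using (Subset; _∈_; _⊆_)
open import Data.Product using (Σ; ∃; _×_; _,_)
open import Data.Sum using (_⊎_)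
open import Relation.Nullary using (¬_)
open import Relation.Binary using (Rel; Decidable; Irreflexive)
open import Relation.Binary.PropositionalEquality using (_≡_)
open import Level using (0ℓ)

record Digraph (n : ℕ) : Set₁ where
  field
    Arc    : Rel (Fin n) 0ℓ
    Arc?   : Decidable Arc
    noLoop : Irreflexive _≡_ Arc
open Digraph public

module _ {n : ℕ} (D : Digraph n) where

  data WalkIn (A : Subset n) : Fin n → Fin n → Set where
    one  : ∀ {u v} → u ∈ A → v ∈ A → Arc D u v → WalkIn A u v
    step : ∀ {u w v} → u ∈ A → Arc D u w → WalkIn A w v → WalkIn A u v

  -- the induced subdigraph D[A] is acyclic: no directed closed walk inside A
  -- (equivalently no directed cycle)
  AcyclicOn : Subset n → Set
  AcyclicOn A = ∀ v → ¬ WalkIn A v v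

  Independent : Subset n → Set
  Independent S = ∀ u v → u ∈ S → v ∈ S → ¬ Arc D u v

  Dist≤2 : Subset n → Fin n → Set
  Dist≤2 S v = v ∈ S
             ⊎ (∃ λ u → u ∈ S × Arc D u v)
             ⊎ (∃ λ u → ∃ λ w → u ∈ S × Arc D u w × Arc D w v)

  IsQuasikernel : Subset n → Set
  IsQuasikernel Q = Independent Q × (∀ v → Dist≤2 Q v)

  InClosedOutNbhd : Subset n → Fin n → Set
  InClosedOutNbhd S v = v ∈ S ⊎ (∃ λ u → u ∈ S × Arc D u v)

{-# OPTIONS --safe #-}
-- Walks inside A form a strict order on a finite set, so every nonempty subset of A has a
-- sink in D.  Build a quasikernel for a vertex set W recursively: choose v ∈ W with no arc
-- into W ∩ A (a sink of W ∩ A, or any vertex if W ∩ A is empty), solve the problem for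
-- W ∖ N⁺[v], and add v to the resulting set Q unless some vertex of Q has an arc to v.
-- The new set stays independent because Q avoids N⁺[v]; v is within distance 1 of it and
-- the out-neighbours of v within distance 2; and the only vertex of W ∩ A inside N⁺[v] is v.
module Submission where

open import Defs
open import Data.Fin using (Fin; _≟_)
open import Data.Fin.Induction using (spo-noetherian)
open import Data.Fin.Properties using (any?)
open import Data.Fin.Subset
  using (Subset; _∈_; _⊆_; _⊂_; _∩_; _∪_; ⁅_⁆; ⊤; Nonempty)
  renaming (⊥ to ∅)
open import Data.Fin.Subset.Induction using (⊂-wellFounded)
open import Data.Fin.Subset.Properties
  using (_∈?_; nonempty?; ∈⊤; ∉⊥; ⊥⊆; x∈⁅x⁆; x∈⁅y⁆⇒x≡y; p⊆p∪q; x∈p∪q⁺; x∈p∪q⁻; x∈p∩q⁺; x∈p∩q⁻)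
open import Data.Nat using (ℕ)
open import Data.Product using (Σ; ∃; _×_; _,_; proj₁; proj₂)
open import Data.Sum using (_⊎_; inj₁; inj₂)
open import Data.Vec using (tabulate)
open import Data.Vec.Properties using (lookup∘tabulate; []=⇒lookup; lookup⇒[]=)
open import Function using (flip; _∘_)
open import Induction.WellFounded using (WellFounded; Acc; acc)
open import Level using (0ℓ)
open import Relation.Binary using (IsStrictPartialOrder; Transitive)
open import Relation.Binary.PropositionalEquality
  using (_≡_; refl; sym; trans; isEquivalence; resp₂)
open import Relation.Nullary using (¬_; yes; no; does; contradiction)
open import Relation.Nullary.Decidable using (dec-true; _×-dec_; _⊎-dec_; ¬?)
open import Relation.Unary using (Pred; Decidable)

module _ {n : ℕ} {P : Pred (Fin n) 0ℓ} (P? : Decidable P) where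

  select : Subset n
  select = tabulate (does ∘ P?)

  ∈-select⁺ : ∀ {x} → P x → x ∈ select
  ∈-select⁺ {x} px = lookup⇒[]= x select (trans (lookup∘tabulate _ x) (dec-true (P? x) px))

  ∈-select⁻ : ∀ {x} → x ∈ select → P x
  ∈-select⁻ {x} x∈ with P? x | trans (sym (lookup∘tabulate _ x)) ([]=⇒lookup x∈)
  ... | yes px | _  = px
  ... | no  _  | ()

module _ {n : ℕ} (D : Digraph n) where

  NoArcInto : Fin n → Subset n → Set
  NoArcInto v S = ∀ w → w ∈ S → ¬ Arc D v w

  Dist≤2-mono : ∀ {Q Q'} → Q ⊆ Q' → ∀ {v} → Dist≤2 D Q v → Dist≤2 D Q' v
  Dist≤2-mono Q⊆Q' (inj₁ v∈Q)                          = inj₁ (Q⊆Q' v∈Q)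
  Dist≤2-mono Q⊆Q' (inj₂ (inj₁ (u , u∈Q , uv)))         = inj₂ (inj₁ (u , Q⊆Q' u∈Q , uv))
  Dist≤2-mono Q⊆Q' (inj₂ (inj₂ (u , w , u∈Q , uw , wv))) = inj₂ (inj₂ (u , w , Q⊆Q' u∈Q , uw , wv))

  InClosedOutNbhd-mono : ∀ {Q Q'} → Q ⊆ Q' →
                         ∀ {v} → InClosedOutNbhd D Q v → InClosedOutNbhd D Q' v
  InClosedOutNbhd-mono Q⊆Q' (inj₁ v∈Q)            = inj₁ (Q⊆Q' v∈Q)
  InClosedOutNbhd-mono Q⊆Q' (inj₂ (u , u∈Q , uv)) = inj₂ (u , Q⊆Q' u∈Q , uv)

  module _ {A : Subset n} where

    WalkIn-trans : Transitive (WalkIn D A)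
    WalkIn-trans (one u∈A _ uw)   q = step u∈A uw q
    WalkIn-trans (step u∈A uw p) q = step u∈A uw (WalkIn-trans p q)

    acyclic⇒WalkIn-isStrictPartialOrder : AcyclicOn D A → IsStrictPartialOrder _≡_ (WalkIn D A)
    acyclic⇒WalkIn-isStrictPartialOrder acyclic = record
      { isEquivalence = isEquivalence
      ; irrefl        = λ { refl → acyclic _ }
      ; trans         = WalkIn-trans
      ; <-resp-≈      = resp₂ (WalkIn D A)
      }

    -- Follow arcs inside S; this terminates since walks inside A are a noetherian order.
    acyclic⇒∃sink : AcyclicOn D A → ∀ {S} → S ⊆ A → Nonempty S → ∃ λ y → y ∈ S × NoArcInto y S
    acyclic⇒∃sink acyclic {S} S⊆A (x , x∈S) = go (noetherian x) x∈S
      where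
      noetherian : WellFounded (flip (WalkIn D A))
      noetherian = spo-noetherian (acyclic⇒WalkIn-isStrictPartialOrder acyclic)

      go : ∀ {x} → Acc (flip (WalkIn D A)) x → x ∈ S → ∃ λ y → y ∈ S × NoArcInto y S
      go {x} (acc walk-on) x∈S with any? (λ t → (t ∈? S) ×-dec Arc? D x t)
      ... | yes (t , t∈S , xt) = go (walk-on (one (S⊆A x∈S) (S⊆A t∈S) xt)) t∈S
      ... | no ∄t              = x , x∈S , λ t t∈S xt → ∄t (t , t∈S , xt)

module _ {n : ℕ} (D : Digraph n) (A : Subset n) where

  record QuasikernelOn (W Q : Subset n) : Set where
    field
      Q⊆W         : Q ⊆ W
      independent : Independent D Q
      dist≤2      : ∀ v → v ∈ W → Dist≤2 D Q v
      covers      : ∀ v → v ∈ W → v ∈ A → InClosedOutNbhd D Q v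

  ∅-quasikernelOn : ∀ {W} → ¬ Nonempty W → QuasikernelOn W ∅
  ∅-quasikernelOn W-empty = record
    { Q⊆W         = ⊥⊆
    ; independent = λ _ _ u∈∅ _ _ → ∉⊥ u∈∅
    ; dist≤2      = λ v v∈W → contradiction (v , v∈W) W-empty
    ; covers      = λ v v∈W _ → contradiction (v , v∈W) W-empty
    }

  module Extend (W : Subset n) (v : Fin n) (v∈W : v ∈ W) (v↛W∩A : NoArcInto D v (W ∩ A)) where

    InN⁺[v] : Pred (Fin n) 0ℓ
    InN⁺[v] u = v ≡ u ⊎ Arc D v u

    inN⁺[v]? : Decidable InN⁺[v]
    inN⁺[v]? u = (v ≟ u) ⊎-dec Arc? D v u

    inW'? : Decidable (λ u → u ∈ W × ¬ InN⁺[v] u)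
    inW'? u = (u ∈? W) ×-dec ¬? (inN⁺[v]? u)

    W' : Subset n
    W' = select inW'?

    W'⊆W : W' ⊆ W
    W'⊆W = proj₁ ∘ ∈-select⁻ inW'?

    W'∌N⁺[v] : ∀ {u} → u ∈ W' → ¬ InN⁺[v] u
    W'∌N⁺[v] u∈W' = let _ , u∉N⁺[v] = ∈-select⁻ inW'? u∈W' in u∉N⁺[v]

    W'⊂W : W' ⊂ W
    W'⊂W = W'⊆W , v , v∈W , λ v∈W' → W'∌N⁺[v] v∈W' (inj₁ refl)

    split : ∀ {u} → u ∈ W → u ∈ W' ⊎ InN⁺[v] u
    split {u} u∈W with inN⁺[v]? u
    ... | yes u∈N⁺[v] = inj₂ u∈N⁺[v]
    ... | no  u∉N⁺[v] = inj₁ (∈-select⁺ inW'? (u∈W , u∉N⁺[v]))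

    module _ {Q : Subset n} (qk : QuasikernelOn W' Q) where
      open QuasikernelOn qk

      absorbed : ∀ {q} → q ∈ Q → Arc D q v → QuasikernelOn W Q
      absorbed {q} q∈Q qv = record
        { Q⊆W         = W'⊆W ∘ Q⊆W
        ; independent = independent
        ; dist≤2      = dist≤2′
        ; covers      = covers′
        }
        where
        dist≤2′ : ∀ u → u ∈ W → Dist≤2 D Q u
        dist≤2′ u u∈W with split u∈W
        ... | inj₁ u∈W'        = dist≤2 u u∈W'
        ... | inj₂ (inj₁ refl) = inj₂ (inj₁ (q , q∈Q , qv))
        ... | inj₂ (inj₂ vu)   = inj₂ (inj₂ (q , v , q∈Q , qv , vu))

        covers′ : ∀ u → u ∈ W → u ∈ A → InClosedOutNbhd D Q u
        covers′ u u∈W u∈A with split u∈W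
        ... | inj₁ u∈W'        = covers u u∈W' u∈A
        ... | inj₂ (inj₁ refl) = inj₂ (q , q∈Q , qv)
        ... | inj₂ (inj₂ vu)   = contradiction vu (v↛W∩A u (x∈p∩q⁺ (u∈W , u∈A)))

      adjoined : (∀ q → q ∈ Q → ¬ Arc D q v) → QuasikernelOn W (Q ∪ ⁅ v ⁆)
      adjoined Q↛v = record
        { Q⊆W         = Q∪v⊆W
        ; independent = independent′
        ; dist≤2      = dist≤2′
        ; covers      = covers′
        }
        where
        Q⊆Q∪v : Q ⊆ Q ∪ ⁅ v ⁆
        Q⊆Q∪v = p⊆p∪q ⁅ v ⁆

        v∈Q∪v : v ∈ Q ∪ ⁅ v ⁆
        v∈Q∪v = x∈p∪q⁺ (inj₂ (x∈⁅x⁆ v))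

        members : ∀ {u} → u ∈ Q ∪ ⁅ v ⁆ → u ∈ Q ⊎ u ≡ v
        members {u} u∈Q∪v with x∈p∪q⁻ Q ⁅ v ⁆ u∈Q∪v
        ... | inj₁ u∈Q = inj₁ u∈Q
        ... | inj₂ u∈v = inj₂ (x∈⁅y⁆⇒x≡y v u∈v)

        Q∪v⊆W : Q ∪ ⁅ v ⁆ ⊆ W
        Q∪v⊆W u∈Q∪v with members u∈Q∪v
        ... | inj₁ u∈Q  = W'⊆W (Q⊆W u∈Q)
        ... | inj₂ refl = v∈W

        independent′ : Independent D (Q ∪ ⁅ v ⁆)
        independent′ u w u∈ w∈ uw with members u∈ | members w∈
        ... | inj₁ u∈Q  | inj₁ w∈Q  = independent u w u∈Q w∈Q uw
        ... | inj₁ u∈Q  | inj₂ refl = Q↛v u u∈Q uw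
        ... | inj₂ refl | inj₁ w∈Q  = W'∌N⁺[v] (Q⊆W w∈Q) (inj₂ uw)
        ... | inj₂ refl | inj₂ refl = noLoop D refl uw

        dist≤2′ : ∀ u → u ∈ W → Dist≤2 D (Q ∪ ⁅ v ⁆) u
        dist≤2′ u u∈W with split u∈W
        ... | inj₁ u∈W'        = Dist≤2-mono D Q⊆Q∪v (dist≤2 u u∈W')
        ... | inj₂ (inj₁ refl) = inj₁ v∈Q∪v
        ... | inj₂ (inj₂ vu)   = inj₂ (inj₁ (v , v∈Q∪v , vu))

        covers′ : ∀ u → u ∈ W → u ∈ A → InClosedOutNbhd D (Q ∪ ⁅ v ⁆) u
        covers′ u u∈W u∈A with split u∈W
        ... | inj₁ u∈W'        = InClosedOutNbhd-mono D Q⊆Q∪v (covers u u∈W' u∈A)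
        ... | inj₂ (inj₁ refl) = inj₁ v∈Q∪v
        ... | inj₂ (inj₂ vu)   = inj₂ (v , v∈Q∪v , vu)

    extend : ∀ {Q} → QuasikernelOn W' Q → Σ (Subset n) (QuasikernelOn W)
    extend {Q} qk with any? (λ q → (q ∈? Q) ×-dec Arc? D q v)
    ... | yes (q , q∈Q , qv) = Q , absorbed qk q∈Q qv
    ... | no  ∄q             = Q ∪ ⁅ v ⁆ , adjoined qk (λ q q∈Q qv → ∄q (q , q∈Q , qv))

  module _ (acyclic : AcyclicOn D A) where

    ∃noArcInto∩A : ∀ {W} → Nonempty W → ∃ λ v → v ∈ W × NoArcInto D v (W ∩ A)
    ∃noArcInto∩A {W} (x , x∈W) with nonempty? (W ∩ A)
    ... | yes W∩A≠∅ =
      let y , y∈W∩A , y↛W∩A = acyclic⇒∃sink D acyclic (proj₂ ∘ x∈p∩q⁻ W A) W∩A≠∅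
      in  y , proj₁ (x∈p∩q⁻ W A y∈W∩A) , y↛W∩A
    ... | no  W∩A=∅ = x , x∈W , λ w w∈W∩A _ → W∩A=∅ (w , w∈W∩A)

    quasikernelOn : ∀ W → Σ (Subset n) (QuasikernelOn W)
    quasikernelOn W = go (⊂-wellFounded W)
      where
      go : ∀ {W} → Acc _⊂_ W → Σ (Subset n) (QuasikernelOn W)
      go {W} (acc smaller) with nonempty? W
      ... | no  W-empty = ∅ , ∅-quasikernelOn W-empty
      ... | yes W≠∅ =
        let v , v∈W , v↛W∩A = ∃noArcInto∩A W≠∅
            open Extend W v v∈W v↛W∩A
        in  extend (proj₂ (go (smaller W'⊂W)))

lemma4p3 : (n : ℕ) (D : Digraph n) (A : Subset n) → AcyclicOn D A →
    Σ (Subset n) (λ Q → IsQuasikernel D Q × (∀ v → v ∈ A → InClosedOutNbhd D Q v))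
lemma4p3 n D A acyclic =
  let Q , qk = quasikernelOn D A acyclic ⊤
      open QuasikernelOn qk
  in  Q , (independent , λ v → dist≤2 v ∈⊤) , λ v → covers v ∈⊤
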